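{- Let $C$ be a quad code of length $\ell>0$ containing $2^k$ codewords, and let $n\ge 0$ be an integer. Then $C$ is realizable in the EvenQuads-$2^n$ deck if and only if \[ n \ge \ell-k-1. \]
   Context: The EvenQuads-$2^n$ deck is the set $\mathbb{Z}_2^n$; its elements are called cards. A binary code of length $\ell$ is called a quad code if it is a linear subspace of $\mathbb{Z}_2^\ell$, every codeword has an even number of ones, and every nonzero codeword has at least 4 ones. Given a sequence of pairwise distinct cards $\vec{a}_1,\dots,\vec{a}_\ell\in\mathbb{Z}_2^n$, the code it realizes is \[ C=\{\boldsymbol{c}=c_1\cdots c_\ell\in\mathbb{Z}_2^\ell : \text{an even number of the } c_i \text{ equal } 1,\ c_1\vec{a}_1+\cdots+c_\ell\vec{a}_\ell=\vec 0\}. \] A code $C$ is realizable in the EvenQuads-$2^n$ deck if some sequence of $\ell$ pairwise distinct cards of $\mathbb{Z}_2^n$ realizes it. -}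

module Defs where

open import Data.Bool using (Bool; true; false; _xor_)
open import Data.Nat using (ℕ; zero; suc; _+_; _*_; _%_; _≤_)
open import Data.Vec using (Vec; []; _∷_; zipWith; replicate; lookup; foldr)
open import Data.Fin using (Fin)
open import Data.List using (List)
open import Data.List.Membership.Propositional using (_∈_)
open import Data.Product using (_×_; Σ)
open import Relation.Binary.PropositionalEquality using (_≡_)
open import Relation.Nullary using (¬_)
open import Function.Bundles using (_⇔_)

-- Elements of Z_2^m are modelled as Vec Bool m (true = 1).
Word : ℕ → Set
Word m = Vec Bool m

_⊕_ : ∀ {m} → Word m → Word m → Word m
_⊕_ = zipWith _xor_

𝟎 : ∀ {m} → Word m
𝟎 = replicate _ false

weight : ∀ {m} → Word m → ℕ
weight [] = 0
weight (true ∷ c) = suc (weight c)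
weight (false ∷ c) = weight c

EvenWeight : ∀ {m} → Word m → Set
EvenWeight c = weight c % 2 ≡ 0

lincomb : ∀ {ℓ n} → Word ℓ → Vec (Word n) ℓ → Word n
lincomb [] [] = 𝟎
lincomb (true ∷ c) (a ∷ as) = a ⊕ lincomb c as
lincomb (false ∷ c) (a ∷ as) = lincomb c as

-- A binary code of length ℓ, given by the (finite) list of its codewords, is a
-- quad code: a linear subspace of Z_2^ℓ (contains 0, closed under addition;
-- over Z_2 this is linearity), every codeword has even weight, and every nonzero
-- codeword has weight at least 4.
record QuadCode {ℓ : ℕ} (C : List (Word ℓ)) : Set where
  field
    zero∈   : 𝟎 ∈ C
    closed  : ∀ {c d} → c ∈ C → d ∈ C → (c ⊕ d) ∈ C
    even    : ∀ {c} → c ∈ C → EvenWeight c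
    minWt   : ∀ {c} → c ∈ C → ¬ (c ≡ 𝟎) → 4 ≤ weight c

Realizes : ∀ {ℓ n} → Vec (Word n) ℓ → List (Word ℓ) → Set
Realizes {ℓ} a C = ∀ (c : Word ℓ) → (c ∈ C) ⇔ (EvenWeight c × lincomb c a ≡ 𝟎)

PairwiseDistinct : ∀ {ℓ n} → Vec (Word n) ℓ → Set
PairwiseDistinct {ℓ} a = ∀ (i j : Fin ℓ) → lookup a i ≡ lookup a j → i ≡ j

Realizable : ∀ {ℓ} → ℕ → List (Word ℓ) → Set
Realizable {ℓ} n C = Σ (Vec (Word n) ℓ) λ a → PairwiseDistinct a × Realizes a C

-- A sequence of cards a is a linear map c ↦ Σ cᵢaᵢ from Z₂^ℓ to Z₂^n, and a realizes C exactly
-- when C is the set of even-weight words in its kernel. Each of the n coordinates of the map is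
-- a linear functional, which at most halves a subspace; applied to the 2^(ℓ-1) even-weight words
-- this gives 2^(ℓ-1) ≤ 2^n · 2^k. Conversely C ∪ (C + e₁) is a subspace of size 2^(k+1), hence
-- the kernel of a map to Z₂^(ℓ-k-1); its even part is C because C + e₁ consists of odd words, and
-- zero coordinates pad the cards to any n ≥ ℓ-k-1. The cards are distinct since aᵢ = aⱼ would
-- put the weight-2 word eᵢ + eⱼ into C.

module Submission where

open import Defs
open import Data.Nat using (ℕ; _+_; _^_; _≤_; _<_)
open import Data.List using (List; length)
open import Data.List.Relation.Unary.Unique.Propositional using (Unique)
open import Relation.Binary.PropositionalEquality using (_≡_)
open import Function.Bundles using (_⇔_)

open import Level using (Level; 0ℓ)
open import Algebra.Bundles using (CommutativeSemigroup; CommutativeRing)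
import Algebra.Properties.CommutativeSemigroup as CommutativeSemigroupProperties
open import Data.Bool using (Bool; true; false; not; _∧_; _xor_)
open import Data.Bool.Properties
  using (xor-assoc; xor-comm; xor-identityˡ; xor-identityʳ; xor-same; ∧-distribʳ-xor; ¬-not; not-injective; xor-∧-commutativeRing)
  renaming (_≟_ to _≟ᵇ_)
open import Data.Empty using (⊥-elim)
open import Data.Fin using (Fin) renaming (zero to fzero; suc to fsuc)
import Data.Fin.Properties as Fin
open import Data.List using ([]; _∷_)
open import Data.List.Membership.Propositional using (_∈_)
import Data.List.Membership.DecPropositional as DecMembership
import Data.List.Relation.Unary.All as All
open import Data.List.Relation.Unary.AllPairs using (_∷_)
open import Data.Nat using (zero; suc; _*_; _∸_; _%_; z≤n; s≤s)
open import Data.Nat.DivMod using ([m+kn]%n≡m%n)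
open import Data.Nat.Properties
open import Data.Product using (Σ; ∃; _×_; _,_; proj₁)
open import Data.Sum using (_⊎_; inj₁; inj₂)
open import Data.Vec using (Vec; []; _∷_; map; head; tail; lookup)
open import Data.Vec.Properties
  using (≡-dec; zipWith-assoc; zipWith-comm; zipWith-identityˡ; zipWith-identityʳ; ∷-injective; ∷-injectiveˡ; ∷-injectiveʳ)
open import Function using (_∘_)
open import Function.Bundles using (mk⇔; Equivalence)
open import Function.Properties.Equivalence using () renaming (refl to ⇔-refl; trans to ⇔-trans; sym to ⇔-sym)
open import Data.Product.Function.NonDependent.Propositional using (_×-⇔_)
open import Relation.Binary.Definitions using (DecidableEquality)
open import Relation.Binary.PropositionalEquality
  using (_≢_; refl; sym; trans; cong; cong₂; subst; isEquivalence; module ≡-Reasoning)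
open import Relation.Nullary using (¬_; Dec; does; yes; no)
open import Relation.Nullary.Decidable using (map′; _⊎-dec_; does-⇔)
open import Relation.Unary using (Pred; Decidable; _⊆_; _∩_)
open import Relation.Unary.Properties using (_∩?_; _∪?_; ∁?)

private
  variable
    p q : Level

open Equivalence using (to; from)

+-interchange : ∀ a b c d → (a + b) + (c + d) ≡ (a + c) + (b + d)
+-interchange = CommutativeSemigroupProperties.interchange +-commutativeSemigroup

xor-interchange : ∀ a b c d → (a xor b) xor (c xor d) ≡ (a xor c) xor (b xor d)
xor-interchange = CommutativeSemigroupProperties.interchange
  (CommutativeRing.+-commutativeSemigroup xor-∧-commutativeRing)

⊕-assoc : ∀ {m} (u v w : Word m) → (u ⊕ v) ⊕ w ≡ u ⊕ (v ⊕ w)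
⊕-assoc = zipWith-assoc xor-assoc

⊕-comm : ∀ {m} (u w : Word m) → u ⊕ w ≡ w ⊕ u
⊕-comm = zipWith-comm xor-comm

⊕-identityˡ : ∀ {m} (u : Word m) → 𝟎 ⊕ u ≡ u
⊕-identityˡ = zipWith-identityˡ xor-identityˡ

⊕-identityʳ : ∀ {m} (u : Word m) → u ⊕ 𝟎 ≡ u
⊕-identityʳ = zipWith-identityʳ xor-identityʳ

⊕-self : ∀ {m} (u : Word m) → u ⊕ u ≡ 𝟎
⊕-self [] = refl
⊕-self (x ∷ u) = cong₂ _∷_ (xor-same x) (⊕-self u)

⊕-commutativeSemigroup : ℕ → CommutativeSemigroup 0ℓ 0ℓ
⊕-commutativeSemigroup m = record
  { Carrier = Word m
  ; _≈_ = _≡_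
  ; _∙_ = _⊕_
  ; isCommutativeSemigroup = record
    { isSemigroup = record
      { isMagma = record { isEquivalence = isEquivalence ; ∙-cong = cong₂ _⊕_ }
      ; assoc = ⊕-assoc
      }
    ; comm = ⊕-comm
    }
  }

module ⊕-Properties {m} = CommutativeSemigroupProperties (⊕-commutativeSemigroup m)
module *-Properties = CommutativeSemigroupProperties *-commutativeSemigroup

⊕-cancelˡ : ∀ {m} (u w : Word m) → u ⊕ (u ⊕ w) ≡ w
⊕-cancelˡ u w = begin
  u ⊕ (u ⊕ w) ≡⟨ ⊕-assoc u u w ⟨
  (u ⊕ u) ⊕ w ≡⟨ cong (_⊕ w) (⊕-self u) ⟩
  𝟎 ⊕ w       ≡⟨ ⊕-identityˡ w ⟩
  w           ∎
  where open ≡-Reasoning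

⊕-cancelʳ : ∀ {m} (u w : Word m) → (w ⊕ u) ⊕ u ≡ w
⊕-cancelʳ u w = begin
  (w ⊕ u) ⊕ u ≡⟨ ⊕-assoc w u u ⟩
  w ⊕ (u ⊕ u) ≡⟨ cong (w ⊕_) (⊕-self u) ⟩
  w ⊕ 𝟎       ≡⟨ ⊕-identityʳ w ⟩
  w           ∎
  where open ≡-Reasoning

-- Linear combinations of cards

lincomb-𝟎 : ∀ {ℓ n} (a : Vec (Word n) ℓ) → lincomb 𝟎 a ≡ 𝟎
lincomb-𝟎 [] = refl
lincomb-𝟎 (_ ∷ a) = lincomb-𝟎 a

lincomb-⊕ : ∀ {ℓ n} (u w : Word ℓ) (a : Vec (Word n) ℓ) →
            lincomb (u ⊕ w) a ≡ lincomb u a ⊕ lincomb w a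
lincomb-⊕ [] [] [] = sym (⊕-self 𝟎)
lincomb-⊕ (false ∷ u) (false ∷ w) (x ∷ a) = lincomb-⊕ u w a
lincomb-⊕ (true ∷ u) (false ∷ w) (x ∷ a) =
  trans (cong (x ⊕_) (lincomb-⊕ u w a)) (sym (⊕-assoc x _ _))
lincomb-⊕ (false ∷ u) (true ∷ w) (x ∷ a) =
  trans (cong (x ⊕_) (lincomb-⊕ u w a)) (⊕-Properties.x∙yz≈y∙xz x _ _)
lincomb-⊕ (true ∷ u) (true ∷ w) (x ∷ a) = begin
  lincomb (u ⊕ w) a       ≡⟨ lincomb-⊕ u w a ⟩
  U ⊕ W                   ≡⟨ ⊕-identityˡ (U ⊕ W) ⟨
  𝟎 ⊕ (U ⊕ W)             ≡⟨ cong (_⊕ (U ⊕ W)) (⊕-self x) ⟨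
  (x ⊕ x) ⊕ (U ⊕ W)       ≡⟨ ⊕-Properties.interchange x x U W ⟩
  (x ⊕ U) ⊕ (x ⊕ W)       ∎
  where
  open ≡-Reasoning
  U = lincomb u a
  W = lincomb w a

lincomb-map-false∷ : ∀ {ℓ m} (w : Word ℓ) (b : Vec (Word m) ℓ) →
                     lincomb w (map (false ∷_) b) ≡ false ∷ lincomb w b
lincomb-map-false∷ [] [] = refl
lincomb-map-false∷ (false ∷ w) (_ ∷ b) = lincomb-map-false∷ w b
lincomb-map-false∷ (true ∷ w) (x ∷ b) = cong ((false ∷ x) ⊕_) (lincomb-map-false∷ w b)

dot : ∀ {ℓ} → Word ℓ → Word ℓ → Bool
dot [] [] = false
dot (c ∷ w) (x ∷ h) = (c ∧ x) xor dot w h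

dot-⊕ : ∀ {ℓ} (u w h : Word ℓ) → dot (u ⊕ w) h ≡ dot u h xor dot w h
dot-⊕ [] [] [] = refl
dot-⊕ (a ∷ u) (b ∷ w) (x ∷ h) = trans
  (cong₂ _xor_ (∧-distribʳ-xor x a b) (dot-⊕ u w h))
  (xor-interchange (a ∧ x) (b ∧ x) (dot u h) (dot w h))

lincomb-∷ : ∀ {ℓ n} (w : Word ℓ) (a : Vec (Word (suc n)) ℓ) →
            lincomb w a ≡ dot w (map head a) ∷ lincomb w (map tail a)
lincomb-∷ [] [] = refl
lincomb-∷ (false ∷ w) ((_ ∷ _) ∷ a) = lincomb-∷ w a
lincomb-∷ (true ∷ w) ((_ ∷ _) ∷ a) rewrite lincomb-∷ w a = refl

basis : ∀ {ℓ} → Fin ℓ → Word ℓ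
basis fzero = true ∷ 𝟎
basis (fsuc i) = false ∷ basis i

lincomb-basis : ∀ {ℓ n} (i : Fin ℓ) (a : Vec (Word n) ℓ) → lincomb (basis i) a ≡ lookup a i
lincomb-basis fzero (x ∷ a) = trans (cong (x ⊕_) (lincomb-𝟎 a)) (⊕-identityʳ x)
lincomb-basis (fsuc i) (_ ∷ a) = lincomb-basis i a

weight-𝟎 : ∀ {ℓ} → weight (𝟎 {ℓ}) ≡ 0
weight-𝟎 {zero} = refl
weight-𝟎 {suc ℓ} = weight-𝟎 {ℓ}

weight-basis : ∀ {ℓ} (i : Fin ℓ) → weight (basis i) ≡ 1
weight-basis {suc ℓ} fzero = cong suc (weight-𝟎 {ℓ})
weight-basis (fsuc i) = weight-basis i

weight-basis⊕basis : ∀ {ℓ} {i j : Fin ℓ} → i ≢ j → weight (basis i ⊕ basis j) ≡ 2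
weight-basis⊕basis {i = fzero} {fzero} i≢j = ⊥-elim (i≢j refl)
weight-basis⊕basis {i = fzero} {fsuc j} _ = cong suc (trans (cong weight (⊕-identityˡ (basis j))) (weight-basis j))
weight-basis⊕basis {i = fsuc i} {fzero} _ = cong suc (trans (cong weight (⊕-identityʳ (basis i))) (weight-basis i))
weight-basis⊕basis {i = fsuc i} {fsuc j} i≢j = weight-basis⊕basis (i≢j ∘ cong fsuc)

toℕ : Bool → ℕ
toℕ false = 0
toℕ true = 1

parity : ∀ {ℓ} → Word ℓ → Bool
parity [] = false
parity (x ∷ w) = x xor parity w

parity-⊕ : ∀ {ℓ} (u w : Word ℓ) → parity (u ⊕ w) ≡ parity u xor parity w
parity-⊕ [] [] = refl
parity-⊕ (x ∷ u) (y ∷ w) = trans (cong ((x xor y) xor_) (parity-⊕ u w)) (xor-interchange x y (parity u) (parity w))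

weight≡parity+2* : ∀ {ℓ} (c : Word ℓ) → ∃ λ h → weight c ≡ toℕ (parity c) + h * 2
weight≡parity+2* [] = 0 , refl
weight≡parity+2* (false ∷ c) = weight≡parity+2* c
weight≡parity+2* (true ∷ c) with parity c | weight≡parity+2* c
... | false | h , eq = h , cong suc eq
... | true  | h , eq = suc h , cong suc eq

weight%2≡parity : ∀ {ℓ} (c : Word ℓ) → weight c % 2 ≡ toℕ (parity c)
weight%2≡parity c with weight≡parity+2* c
... | h , eq = trans (cong (_% 2) eq) (trans ([m+kn]%n≡m%n (toℕ (parity c)) h 2) (toℕ%2 (parity c)))
  where
  toℕ%2 : ∀ b → toℕ b % 2 ≡ toℕ b
  toℕ%2 false = refl
  toℕ%2 true = refl

EvenWeight⇔parity≡false : ∀ {ℓ} (c : Word ℓ) → EvenWeight c ⇔ parity c ≡ false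
EvenWeight⇔parity≡false c = mk⇔ (toℕ-injective ∘ trans (sym (weight%2≡parity c))) (trans (weight%2≡parity c) ∘ cong toℕ)
  where
  toℕ-injective : ∀ {b} → toℕ b ≡ 0 → b ≡ false
  toℕ-injective {false} _ = refl

EvenWeight? : ∀ {ℓ} → Decidable (EvenWeight {ℓ})
EvenWeight? c = weight c % 2 ≟ 0

EvenWeight-⊕ : ∀ {ℓ} (u w : Word ℓ) → EvenWeight u → EvenWeight w → EvenWeight (u ⊕ w)
EvenWeight-⊕ u w eu ew = from (EvenWeight⇔parity≡false (u ⊕ w)) (begin
  parity (u ⊕ w)          ≡⟨ parity-⊕ u w ⟩
  parity u xor parity w   ≡⟨ cong₂ _xor_ (to (EvenWeight⇔parity≡false u) eu) (to (EvenWeight⇔parity≡false w) ew) ⟩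
  false                   ∎)
  where open ≡-Reasoning

EvenWeight-true∷ : ∀ {ℓ} (w : Word ℓ) → EvenWeight (true ∷ w) ⇔ (¬ EvenWeight w)
EvenWeight-true∷ w = mk⇔
  (λ ev ew → true≢false (trans (sym (not-injective (to (E (true ∷ w)) ev))) (to (E w) ew)))
  (λ ¬ev → from (E (true ∷ w)) (cong not (¬-not (¬ev ∘ from (E w)))))
  where
  E = EvenWeight⇔parity≡false
  true≢false : true ≢ false
  true≢false ()

-- Sums over Z₂^ℓ and counting

sumWords : ∀ {ℓ} → (Word ℓ → ℕ) → ℕ
sumWords {zero} f = f []
sumWords {suc ℓ} f = sumWords (f ∘ (false ∷_)) + sumWords (f ∘ (true ∷_))

sumWords-cong : ∀ {ℓ} {f g : Word ℓ → ℕ} → (∀ w → f w ≡ g w) → sumWords f ≡ sumWords g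
sumWords-cong {zero} f≗g = f≗g []
sumWords-cong {suc ℓ} f≗g = cong₂ _+_ (sumWords-cong (f≗g ∘ (false ∷_))) (sumWords-cong (f≗g ∘ (true ∷_)))

sumWords-mono : ∀ {ℓ} {f g : Word ℓ → ℕ} → (∀ w → f w ≤ g w) → sumWords f ≤ sumWords g
sumWords-mono {zero} f≤g = f≤g []
sumWords-mono {suc ℓ} f≤g = +-mono-≤ (sumWords-mono (f≤g ∘ (false ∷_))) (sumWords-mono (f≤g ∘ (true ∷_)))

sumWords-+ : ∀ {ℓ} (f g : Word ℓ → ℕ) → sumWords (λ w → f w + g w) ≡ sumWords f + sumWords g
sumWords-+ {zero} f g = refl
sumWords-+ {suc ℓ} f g = trans
  (cong₂ _+_ (sumWords-+ (f ∘ (false ∷_)) (g ∘ (false ∷_))) (sumWords-+ (f ∘ (true ∷_)) (g ∘ (true ∷_))))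
  (+-interchange (sumWords (f ∘ (false ∷_))) (sumWords (g ∘ (false ∷_))) (sumWords (f ∘ (true ∷_))) (sumWords (g ∘ (true ∷_))))

sumWords-const : ∀ ℓ c → sumWords {ℓ} (λ _ → c) ≡ 2 ^ ℓ * c
sumWords-const zero c = sym (*-identityˡ c)
sumWords-const (suc ℓ) c = begin
  sumWords {ℓ} (λ _ → c) + sumWords {ℓ} (λ _ → c) ≡⟨ cong₂ _+_ (sumWords-const ℓ c) (sumWords-const ℓ c) ⟩
  2 ^ ℓ * c + 2 ^ ℓ * c                           ≡⟨ *-distribʳ-+ c (2 ^ ℓ) (2 ^ ℓ) ⟨
  (2 ^ ℓ + 2 ^ ℓ) * c                             ≡⟨ cong (λ t → (2 ^ ℓ + t) * c) (+-identityʳ (2 ^ ℓ)) ⟨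
  2 ^ suc ℓ * c                                   ∎
  where open ≡-Reasoning

sumWords-translate : ∀ {ℓ} (f : Word ℓ → ℕ) (s : Word ℓ) → sumWords (λ w → f (w ⊕ s)) ≡ sumWords f
sumWords-translate {zero} f [] = refl
sumWords-translate {suc ℓ} f (false ∷ s) =
  cong₂ _+_ (sumWords-translate (f ∘ (false ∷_)) s) (sumWords-translate (f ∘ (true ∷_)) s)
sumWords-translate {suc ℓ} f (true ∷ s) = trans
  (cong₂ _+_ (sumWords-translate (f ∘ (true ∷_)) s) (sumWords-translate (f ∘ (false ∷_)) s))
  (+-comm (sumWords (f ∘ (true ∷_))) (sumWords (f ∘ (false ∷_))))

count : ∀ {ℓ} {P : Pred (Word ℓ) p} → Decidable P → ℕ
count P? = sumWords (λ w → toℕ (does (P? w)))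

module _ {ℓ} {P : Pred (Word ℓ) p} (P? : Decidable P) where

  count-∁ : count P? + count (∁? P?) ≡ 2 ^ ℓ
  count-∁ = begin
    count P? + count (∁? P?) ≡⟨ sumWords-+ (toℕ ∘ does ∘ P?) (toℕ ∘ does ∘ ∁? P?) ⟨
    sumWords (λ w → toℕ (does (P? w)) + toℕ (does (∁? P? w))) ≡⟨ sumWords-cong one ⟩
    sumWords {ℓ} (λ _ → 1) ≡⟨ sumWords-const ℓ 1 ⟩
    2 ^ ℓ * 1 ≡⟨ *-identityʳ (2 ^ ℓ) ⟩
    2 ^ ℓ ∎
    where
    open ≡-Reasoning
    one : ∀ w → toℕ (does (P? w)) + toℕ (does (∁? P? w)) ≡ 1
    one w with P? w
    ... | yes _ = refl
    ... | no _ = refl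

  count-∅ : (∀ w → ¬ P w) → count P? ≡ 0
  count-∅ ∅ = trans (sumWords-cong vanishes) (trans (sumWords-const ℓ 0) (*-zeroʳ (2 ^ ℓ)))
    where
    vanishes : ∀ w → toℕ (does (P? w)) ≡ 0
    vanishes w with P? w
    ... | yes Pw = ⊥-elim (∅ w Pw)
    ... | no _ = refl

  count-translate : ∀ s → count (λ w → P? (w ⊕ s)) ≡ count P?
  count-translate = sumWords-translate (λ w → toℕ (does (P? w)))

  module _ {Q : Pred (Word ℓ) q} (Q? : Decidable Q) where

    count-cong : (∀ w → P w ⇔ Q w) → count P? ≡ count Q?
    count-cong P⇔Q = sumWords-cong (λ w → cong toℕ (does-⇔ (P⇔Q w) (P? w) (Q? w)))

    count-mono : P ⊆ Q → count P? ≤ count Q?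
    count-mono P⊆Q = sumWords-mono pointwise
      where
      pointwise : ∀ w → toℕ (does (P? w)) ≤ toℕ (does (Q? w))
      pointwise w with P? w | Q? w
      ... | no _  | _     = z≤n
      ... | yes _ | yes _ = ≤-refl
      ... | yes Pw | no ¬Qw = ⊥-elim (¬Qw (P⊆Q Pw))

    count-∪ : (∀ w → P w → ¬ Q w) → count (P? ∪? Q?) ≡ count P? + count Q?
    count-∪ disjoint = trans (sumWords-cong pointwise) (sumWords-+ (toℕ ∘ does ∘ P?) (toℕ ∘ does ∘ Q?))
      where
      pointwise : ∀ w → toℕ (does ((P? ∪? Q?) w)) ≡ toℕ (does (P? w)) + toℕ (does (Q? w))
      pointwise w with P? w | Q? w
      ... | yes Pw | yes Qw = ⊥-elim (disjoint w Pw Qw)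
      ... | yes _ | no _  = refl
      ... | no _  | yes _ = refl
      ... | no _  | no _  = refl

    count-∩-∁ : count P? ≡ count (P? ∩? Q?) + count (P? ∩? ∁? Q?)
    count-∩-∁ = trans (sumWords-cong pointwise) (sumWords-+ (toℕ ∘ does ∘ (P? ∩? Q?)) (toℕ ∘ does ∘ (P? ∩? ∁? Q?)))
      where
      pointwise : ∀ w → toℕ (does (P? w)) ≡ toℕ (does ((P? ∩? Q?) w)) + toℕ (does ((P? ∩? ∁? Q?) w))
      pointwise w with P? w | Q? w
      ... | yes _ | yes _ = refl
      ... | yes _ | no _  = refl
      ... | no _  | _     = refl

_≟ʷ_ : ∀ {ℓ} → DecidableEquality (Word ℓ)
_≟ʷ_ = ≡-dec _≟ᵇ_

_∈?_ : ∀ {ℓ} (w : Word ℓ) (C : List (Word ℓ)) → Dec (w ∈ C)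
w ∈? C = DecMembership._∈?_ _≟ʷ_ w C

count-≡ : ∀ {ℓ} (x : Word ℓ) → count (_≟ʷ x) ≡ 1
count-≡ [] = refl
count-≡ (false ∷ x) = cong₂ _+_ (count-≡ x) (count-∅ (λ w → (true ∷ w) ≟ʷ (false ∷ x)) (λ _ ()))
count-≡ (true ∷ x) = cong₂ _+_ (count-∅ (λ w → (false ∷ w) ≟ʷ (true ∷ x)) (λ _ ())) (count-≡ x)

count-∈ : ∀ {ℓ} {xs : List (Word ℓ)} → Unique xs → count (_∈? xs) ≡ length xs
count-∈ {ℓ} {xs = []} _ = count-∅ {ℓ = ℓ} (_∈? []) (λ _ ())
count-∈ {xs = x ∷ xs} (x∉xs ∷ unique) = begin
  count (_∈? (x ∷ xs))                 ≡⟨ count-∪ (_≟ʷ x) (_∈? xs) (λ { w refl w∈xs → All.lookup x∉xs w∈xs refl }) ⟩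
  count (_≟ʷ x) + count (_∈? xs)       ≡⟨ cong₂ _+_ (count-≡ x) (count-∈ unique) ⟩
  suc (length xs)                      ∎
  where open ≡-Reasoning

any? : ∀ {ℓ} {P : Pred (Word ℓ) p} → Decidable P → Dec (∃ P)
any? {ℓ = zero} P? = map′ ([] ,_) (λ { ([] , P[]) → P[] }) (P? [])
any? {ℓ = suc ℓ} {P = P} P? = map′ from⊎ to⊎ (any? (P? ∘ (false ∷_)) ⊎-dec any? (P? ∘ (true ∷_)))
  where
  from⊎ : ∃ (P ∘ (false ∷_)) ⊎ ∃ (P ∘ (true ∷_)) → ∃ P
  from⊎ (inj₁ (w , Pw)) = false ∷ w , Pw
  from⊎ (inj₂ (w , Pw)) = true ∷ w , Pw
  to⊎ : ∃ P → ∃ (P ∘ (false ∷_)) ⊎ ∃ (P ∘ (true ∷_))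
  to⊎ (false ∷ w , Pw) = inj₁ (w , Pw)
  to⊎ (true ∷ w , Pw) = inj₂ (w , Pw)

-- Closed sets of words, hyperplanes and kernels

Closed : ∀ {ℓ} → Pred (Word ℓ) p → Set p
Closed P = ∀ {u w} → P u → P w → P (u ⊕ w)

Orth : ∀ {ℓ} → Word ℓ → Pred (Word ℓ) 0ℓ
Orth h w = dot w h ≡ false

Orth? : ∀ {ℓ} (h : Word ℓ) → Decidable (Orth h)
Orth? h w = dot w h ≟ᵇ false

Ker : ∀ {ℓ n} → Vec (Word n) ℓ → Pred (Word ℓ) 0ℓ
Ker a w = lincomb w a ≡ 𝟎

Ker? : ∀ {ℓ n} (a : Vec (Word n) ℓ) → Decidable (Ker a)
Ker? a w = lincomb w a ≟ʷ 𝟎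

Ker-∷ : ∀ {ℓ n} (a : Vec (Word (suc n)) ℓ) (w : Word ℓ) → Ker a w ⇔ (Orth (map head a) w × Ker (map tail a) w)
Ker-∷ a w = mk⇔
  (λ eq → ∷-injective (trans (sym (lincomb-∷ w a)) eq))
  (λ (⊥h , ker) → trans (lincomb-∷ w a) (cong₂ _∷_ ⊥h ker))

Ker-map-false∷ : ∀ {ℓ n} (b : Vec (Word n) ℓ) (w : Word ℓ) → Ker (map (false ∷_) b) w ⇔ Ker b w
Ker-map-false∷ b w = mk⇔
  (λ eq → ∷-injectiveʳ (trans (sym (lincomb-map-false∷ w b)) eq))
  (λ eq → trans (lincomb-map-false∷ w b) (cong (false ∷_) eq))

Closed-∩-Orth : ∀ {ℓ} {P : Pred (Word ℓ) p} → Closed P → (h : Word ℓ) → Closed (P ∩ Orth h)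
Closed-∩-Orth closed h {u} {w} (Pu , u⊥h) (Pw , w⊥h) =
  closed Pu Pw , trans (dot-⊕ u w h) (cong₂ _xor_ u⊥h w⊥h)

¬Orth-⊕ : ∀ {ℓ} (h : Word ℓ) {u w : Word ℓ} → ¬ Orth h u → ¬ Orth h w → Orth h (u ⊕ w)
¬Orth-⊕ h {u} {w} u⊥̸h w⊥̸h = trans (dot-⊕ u w h) (cong₂ _xor_ (¬-not u⊥̸h) (¬-not w⊥̸h))

-- Translation by an element of P off the hyperplane maps the part of P off the hyperplane
-- into the part on it.
count-≤-2*count-∩-Orth : ∀ {ℓ} {P : Pred (Word ℓ) p} (P? : Decidable P) → Closed P → (h : Word ℓ) →
                         count P? ≤ 2 * count (P? ∩? Orth? h)
count-≤-2*count-∩-Orth {P = P} P? closed h = begin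
  count P?                                   ≡⟨ count-∩-∁ P? (Orth? h) ⟩
  count on + count (P? ∩? ∁? (Orth? h))     ≤⟨ +-monoʳ-≤ (count on) off≤on ⟩
  count on + count on                        ≡⟨ cong (count on +_) (+-identityʳ (count on)) ⟨
  2 * count on                               ∎
  where
  open ≤-Reasoning
  on = P? ∩? Orth? h
  off≤on : count (P? ∩? ∁? (Orth? h)) ≤ count on
  off≤on with any? (P? ∩? ∁? (Orth? h))
  ... | no ∄ = ≤-trans (≤-reflexive (count-∅ (P? ∩? ∁? (Orth? h)) (λ w off → ∄ (w , off)))) z≤n
  ... | yes (s , Ps , s⊥̸h) = begin
    count (P? ∩? ∁? (Orth? h))                   ≡⟨ count-translate (P? ∩? ∁? (Orth? h)) s ⟨
    count (λ w → (P? ∩? ∁? (Orth? h)) (w ⊕ s))   ≤⟨ count-mono (λ w → (P? ∩? ∁? (Orth? h)) (w ⊕ s)) on shift ⟩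
    count on                                      ∎
    where
    shift : ∀ {w} → P (w ⊕ s) × ¬ Orth h (w ⊕ s) → P w × Orth h w
    shift {w} (Pw⊕s , w⊕s⊥̸h) =
      subst P (⊕-cancelʳ s w) (closed Pw⊕s Ps) , subst (Orth h) (⊕-cancelʳ s w) (¬Orth-⊕ h {w ⊕ s} w⊕s⊥̸h s⊥̸h)

count-≤-2^n*count-∩-Ker : ∀ {ℓ n} {P : Pred (Word ℓ) p} (P? : Decidable P) → Closed P →
                          (a : Vec (Word n) ℓ) → count P? ≤ 2 ^ n * count (P? ∩? Ker? a)
count-≤-2^n*count-∩-Ker {n = zero} P? _ a = ≤-reflexive (begin
  count P?                    ≡⟨ count-cong P? (P? ∩? Ker? a) (λ w → mk⇔ (_, dim0 (lincomb w a)) proj₁) ⟩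
  count (P? ∩? Ker? a)        ≡⟨ *-identityˡ (count (P? ∩? Ker? a)) ⟨
  1 * count (P? ∩? Ker? a)    ∎)
  where
  open ≡-Reasoning
  dim0 : (v : Word 0) → v ≡ 𝟎
  dim0 [] = refl
count-≤-2^n*count-∩-Ker {n = suc n} {P = P} P? closed a = begin
  count P?                                         ≤⟨ count-≤-2*count-∩-Orth P? closed h ⟩
  2 * count on                                     ≤⟨ *-monoʳ-≤ 2 (count-≤-2^n*count-∩-Ker on (Closed-∩-Orth {P = P} closed h) a′) ⟩
  2 * (2 ^ n * count (on ∩? Ker? a′))              ≡⟨ *-assoc 2 (2 ^ n) _ ⟨
  2 ^ suc n * count (on ∩? Ker? a′)                ≡⟨ cong (2 ^ suc n *_) (count-cong (on ∩? Ker? a′) (P? ∩? Ker? a) regroup) ⟩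
  2 ^ suc n * count (P? ∩? Ker? a)                 ∎
  where
  open ≤-Reasoning
  h = map head a
  a′ = map tail a
  on = P? ∩? Orth? h
  regroup : ∀ w → ((P w × Orth h w) × Ker a′ w) ⇔ (P w × Ker a w)
  regroup w = mk⇔
    (λ ((Pw , w⊥h) , ker) → Pw , from (Ker-∷ a w) (w⊥h , ker))
    (λ (Pw , ker) → let (w⊥h , ker′) = to (Ker-∷ a w) ker in (Pw , w⊥h) , ker′)

kernel-representation : ∀ {ℓ} {P : Pred (Word ℓ) p} (P? : Decidable P) → P 𝟎 → Closed P →
  Σ ℕ λ m → Σ (Vec (Word m) ℓ) λ b → (∀ w → P w ⇔ Ker b w) × 2 ^ ℓ ≡ 2 ^ m * count P?
kernel-representation {ℓ = zero} P? P𝟎 _ with P? []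
... | yes _ = 0 , [] , (λ { [] → mk⇔ (λ _ → refl) (λ _ → P𝟎) }) , refl
... | no ¬P𝟎 = ⊥-elim (¬P𝟎 P𝟎)
kernel-representation {ℓ = suc ℓ} {P = P} P? P𝟎 closed
  with kernel-representation (P? ∘ (false ∷_)) P𝟎 (λ {u} {w} → closed {false ∷ u} {false ∷ w})
... | m , b , P⇔Ker , 2^ℓ≡ with any? (P? ∘ (true ∷_))
...   | yes (u , Pu) = m , lincomb u b ∷ b , P⇔Ker′ , (begin
  2 * 2 ^ ℓ              ≡⟨ cong (2 *_) 2^ℓ≡ ⟩
  2 * (2 ^ m * c)        ≡⟨ *-Properties.x∙yz≈y∙xz 2 (2 ^ m) c ⟩
  2 ^ m * (c + (c + 0))  ≡⟨ cong (λ t → 2 ^ m * (c + t)) (trans (+-identityʳ c) (sym odd-part)) ⟩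
  2 ^ m * count P?       ∎)
  where
  open ≡-Reasoning
  c = count (P? ∘ (false ∷_))
  -- The words of P with first bit 1 are the translates by u of those with first bit 0,
  -- so the first card has to be Σ uᵢbᵢ.
  shift : ∀ w → P (true ∷ w) ⇔ P (false ∷ (w ⊕ u))
  shift w = mk⇔ (λ Pw → closed {true ∷ w} {true ∷ u} Pw Pu)
                (λ Pw⊕u → subst (P ∘ (true ∷_)) (⊕-cancelʳ u w) (closed {false ∷ (w ⊕ u)} {true ∷ u} Pw⊕u Pu))
  odd-part : count (P? ∘ (true ∷_)) ≡ c
  odd-part = trans (count-cong (P? ∘ (true ∷_)) (λ w → P? (false ∷ (w ⊕ u))) shift)
                   (count-translate (P? ∘ (false ∷_)) u)
  P⇔Ker′ : ∀ w → P w ⇔ Ker (lincomb u b ∷ b) w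
  P⇔Ker′ (false ∷ w) = P⇔Ker w
  P⇔Ker′ (true ∷ w) = ⇔-trans (shift w) (⇔-trans (P⇔Ker (w ⊕ u)) (mk⇔ (trans (sym eq)) (trans eq)))
    where
    eq : lincomb (w ⊕ u) b ≡ lincomb u b ⊕ lincomb w b
    eq = trans (lincomb-⊕ w u b) (⊕-comm (lincomb w b) (lincomb u b))
...   | no ∄ = suc m , (true ∷ 𝟎) ∷ map (false ∷_) b , P⇔Ker′ , (begin
  2 * 2 ^ ℓ              ≡⟨ cong (2 *_) 2^ℓ≡ ⟩
  2 * (2 ^ m * c)        ≡⟨ *-assoc 2 (2 ^ m) c ⟨
  2 ^ suc m * c          ≡⟨ cong (2 ^ suc m *_) (trans (cong (c +_) odd-part) (+-identityʳ c)) ⟨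
  2 ^ suc m * count P?   ∎)
  where
  open ≡-Reasoning
  c = count (P? ∘ (false ∷_))
  odd-part : count (P? ∘ (true ∷_)) ≡ 0
  odd-part = count-∅ (P? ∘ (true ∷_)) (λ w Pw → ∄ (w , Pw))
  P⇔Ker′ : ∀ w → P w ⇔ Ker ((true ∷ 𝟎) ∷ map (false ∷_) b) w
  P⇔Ker′ (false ∷ w) = ⇔-trans (P⇔Ker w) (⇔-sym (Ker-map-false∷ b w))
  P⇔Ker′ (true ∷ w) = mk⇔ (λ Pw → ⊥-elim (∄ (w , Pw))) (λ eq → ⊥-elim (true≢false (∷-injectiveˡ
    (trans (cong ((true ∷ 𝟎) ⊕_) (sym (lincomb-map-false∷ w b))) eq))))
    where
    true≢false : true ≢ false
    true≢false ()

-- Realizations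

^-cancelʳ-≤ : ∀ m {a b} → 1 < m → m ^ a ≤ m ^ b → a ≤ b
^-cancelʳ-≤ m 1<m mᵃ≤mᵇ = ≮⇒≥ (λ b<a → <⇒≱ (^-monoʳ-< m 1<m b<a) mᵃ≤mᵇ)

¬EvenWeight-basis : ∀ {ℓ} (i : Fin ℓ) → ¬ EvenWeight (basis i)
¬EvenWeight-basis i ev with () ← trans (cong (_% 2) (sym (weight-basis i))) ev

count-EvenWeight : ∀ {ℓ} → count (EvenWeight? {suc ℓ}) ≡ 2 ^ ℓ
count-EvenWeight {ℓ} = begin
  count (EvenWeight? {ℓ}) + count true∷?  ≡⟨ cong (count (EvenWeight? {ℓ}) +_) (count-cong true∷? (∁? (EvenWeight? {ℓ})) EvenWeight-true∷) ⟩
  count (EvenWeight? {ℓ}) + count (∁? (EvenWeight? {ℓ}))  ≡⟨ count-∁ (EvenWeight? {ℓ}) ⟩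
  2 ^ ℓ                                    ∎
  where
  open ≡-Reasoning
  true∷? : Decidable (λ (w : Word ℓ) → EvenWeight (true ∷ w))
  true∷? w = EvenWeight? (true ∷ w)

Realizes⇒count-EvenWeight≤2^n*count : ∀ {ℓ n} {C : List (Word ℓ)} {a : Vec (Word n) ℓ} → Realizes a C →
                       count (EvenWeight? {ℓ}) ≤ 2 ^ n * count (_∈? C)
Realizes⇒count-EvenWeight≤2^n*count {ℓ} {n} {C} {a} R = begin
  count (EvenWeight? {ℓ})                    ≤⟨ count-≤-2^n*count-∩-Ker EvenWeight? (λ {u} {w} → EvenWeight-⊕ u w) a ⟩
  2 ^ n * count (EvenWeight? ∩? Ker? a)      ≡⟨ cong (2 ^ n *_) (count-cong (EvenWeight? ∩? Ker? a) (_∈? C) (⇔-sym ∘ R)) ⟩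
  2 ^ n * count (_∈? C)                      ∎
  where open ≤-Reasoning

Realizes⇒PairwiseDistinct : ∀ {ℓ n} {C : List (Word ℓ)} {a : Vec (Word n) ℓ} → QuadCode C → Realizes a C →
                            PairwiseDistinct a
Realizes⇒PairwiseDistinct {ℓ} {C = C} {a} qc R i j aᵢ≡aⱼ with i Fin.≟ j
... | yes i≡j = i≡j
... | no i≢j = ⊥-elim (4≰2 (subst (4 ≤_) weight-w (QuadCode.minWt qc w∈C w≢𝟎)))
  where
  w = basis i ⊕ basis j
  weight-w : weight w ≡ 2
  weight-w = weight-basis⊕basis i≢j
  w∈C : w ∈ C
  w∈C = from (R w) (cong (_% 2) weight-w , (begin
    lincomb w a                                   ≡⟨ lincomb-⊕ (basis i) (basis j) a ⟩
    lincomb (basis i) a ⊕ lincomb (basis j) a     ≡⟨ cong₂ _⊕_ (lincomb-basis i a) (lincomb-basis j a) ⟩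
    lookup a i ⊕ lookup a j                       ≡⟨ cong (_⊕ lookup a j) aᵢ≡aⱼ ⟩
    lookup a j ⊕ lookup a j                       ≡⟨ ⊕-self (lookup a j) ⟩
    𝟎                                             ∎))
    where open ≡-Reasoning
  w≢𝟎 : w ≢ 𝟎
  w≢𝟎 w≡𝟎 with () ← trans (sym weight-w) (trans (cong weight w≡𝟎) (weight-𝟎 {ℓ}))
  4≰2 : ¬ 4 ≤ 2
  4≰2 (s≤s (s≤s ()))

Realizes-map-false∷ : ∀ {ℓ n} {C : List (Word ℓ)} {a : Vec (Word n) ℓ} → Realizes a C → Realizes (map (false ∷_) a) C
Realizes-map-false∷ {a = a} R c = ⇔-trans (R c) (⇔-refl ×-⇔ ⇔-sym (Ker-map-false∷ a c))

Realizes-raise : ∀ {ℓ m n} {C : List (Word ℓ)} {a : Vec (Word m) ℓ} → m ≤ n → Realizes a C →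
                 Σ (Vec (Word n) ℓ) λ a′ → Realizes a′ C
Realizes-raise {ℓ} {m} {n} {C} m≤n R =
  subst (λ k → Σ (Vec (Word k) ℓ) λ a′ → Realizes a′ C) (m∸n+n≡m m≤n) (pad (n ∸ m) R)
  where
  pad : ∀ d {a : Vec (Word m) ℓ} → Realizes a C → Σ (Vec (Word (d + m)) ℓ) λ a′ → Realizes a′ C
  pad zero R = _ , R
  pad (suc d) R with a′ , R′ ← pad d R = map (false ∷_) a′ , Realizes-map-false∷ R′

EvenWeight-⊕-basis : ∀ {ℓ} (w : Word ℓ) (i : Fin ℓ) → EvenWeight w → ¬ EvenWeight (w ⊕ basis i)
EvenWeight-⊕-basis w i ev ev′ =
  ¬EvenWeight-basis i (subst EvenWeight (⊕-cancelˡ w (basis i)) (EvenWeight-⊕ w (w ⊕ basis i) ev ev′))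

module _ {ℓ} {C : List (Word (suc ℓ))} (qc : QuadCode C) where
  open QuadCode qc

  private
    e₁ : Word (suc ℓ)
    e₁ = basis fzero

    D : Pred (Word (suc ℓ)) 0ℓ
    D w = w ∈ C ⊎ (w ⊕ e₁) ∈ C

    D? : Decidable D
    D? = (_∈? C) ∪? (λ w → (w ⊕ e₁) ∈? C)

    D-closed : Closed D
    D-closed {u} {w} (inj₁ u∈C) (inj₁ w∈C) = inj₁ (closed u∈C w∈C)
    D-closed {u} {w} (inj₁ u∈C) (inj₂ w⊕e₁∈C) = inj₂ (subst (_∈ C) (sym (⊕-assoc u w e₁)) (closed u∈C w⊕e₁∈C))
    D-closed {u} {w} (inj₂ u⊕e₁∈C) (inj₁ w∈C) = subst D (⊕-comm w u) (D-closed (inj₁ w∈C) (inj₂ u⊕e₁∈C))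
    D-closed {u} {w} (inj₂ u⊕e₁∈C) (inj₂ w⊕e₁∈C) = inj₁ (subst (_∈ C) cancel (closed u⊕e₁∈C w⊕e₁∈C))
      where
      open ≡-Reasoning
      cancel : (u ⊕ e₁) ⊕ (w ⊕ e₁) ≡ u ⊕ w
      cancel = begin
        (u ⊕ e₁) ⊕ (w ⊕ e₁)   ≡⟨ ⊕-Properties.interchange u e₁ w e₁ ⟩
        (u ⊕ w) ⊕ (e₁ ⊕ e₁)   ≡⟨ cong ((u ⊕ w) ⊕_) (⊕-self e₁) ⟩
        (u ⊕ w) ⊕ 𝟎           ≡⟨ ⊕-identityʳ (u ⊕ w) ⟩
        u ⊕ w                 ∎

    C-odd-disjoint : ∀ w → w ∈ C → ¬ (w ⊕ e₁) ∈ C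
    C-odd-disjoint w w∈C w⊕e₁∈C = EvenWeight-⊕-basis w fzero (even w∈C) (even w⊕e₁∈C)

    count-D : count D? ≡ count (_∈? C) + count (_∈? C)
    count-D = trans (count-∪ (_∈? C) (λ w → (w ⊕ e₁) ∈? C) C-odd-disjoint)
                    (cong (count (_∈? C) +_) (count-translate (_∈? C) e₁))

  QuadCode⇒Realizes : Σ ℕ λ m → Σ (Vec (Word m) (suc ℓ)) λ a → Realizes a C × 2 ^ ℓ ≡ 2 ^ m * count (_∈? C)
  QuadCode⇒Realizes with m , a , D⇔Ker , 2^ℓ≡ ← kernel-representation D? (inj₁ zero∈) D-closed =
    m , a , R , *-cancelˡ-≡ (2 ^ ℓ) (2 ^ m * c) 2 (begin
      2 * 2 ^ ℓ          ≡⟨ 2^ℓ≡ ⟩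
      2 ^ m * count D?   ≡⟨ cong (2 ^ m *_) (trans count-D (cong (c +_) (sym (+-identityʳ c)))) ⟩
      2 ^ m * (2 * c)    ≡⟨ *-Properties.x∙yz≈y∙xz (2 ^ m) 2 c ⟩
      2 * (2 ^ m * c)    ∎)
    where
    open ≡-Reasoning
    c = count (_∈? C)
    R : Realizes a C
    R w = mk⇔ (λ w∈C → even w∈C , to (D⇔Ker w) (inj₁ w∈C)) in-C
      where
      in-C : EvenWeight w × Ker a w → w ∈ C
      in-C (ev , ker) with from (D⇔Ker w) ker
      ... | inj₁ w∈C = w∈C
      ... | inj₂ w⊕e₁∈C = ⊥-elim (EvenWeight-⊕-basis w fzero ev (even w⊕e₁∈C))

theorem3 : (ℓ : ℕ) → 0 < ℓ → (C : List (Word ℓ)) → QuadCode C →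
           (k : ℕ) → Unique C → length C ≡ 2 ^ k →
           (n : ℕ) → Realizable n C ⇔ (ℓ ≤ n + k + 1)
theorem3 (suc ℓ) _ C qc k unique |C|≡2^k n = mk⇔ necessary sufficient
  where
  open ≤-Reasoning
  count-C : count (_∈? C) ≡ 2 ^ k
  count-C = trans (count-∈ unique) |C|≡2^k
  n+k+1≡1+n+k : n + k + 1 ≡ suc (n + k)
  n+k+1≡1+n+k = +-comm (n + k) 1

  necessary : Realizable n C → suc ℓ ≤ n + k + 1
  necessary (a , _ , R) = subst (suc ℓ ≤_) (sym n+k+1≡1+n+k) (s≤s (^-cancelʳ-≤ 2 (s≤s (s≤s z≤n)) (begin
    2 ^ ℓ                           ≡⟨ count-EvenWeight {ℓ} ⟨
    count (EvenWeight? {suc ℓ})     ≤⟨ Realizes⇒count-EvenWeight≤2^n*count R ⟩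
    2 ^ n * count (_∈? C)           ≡⟨ cong (2 ^ n *_) count-C ⟩
    2 ^ n * 2 ^ k                   ≡⟨ ^-distribˡ-+-* 2 n k ⟨
    2 ^ (n + k)                     ∎)))

  minimal≤n : ∀ {m} → suc ℓ ≤ n + k + 1 → 2 ^ ℓ ≡ 2 ^ m * count (_∈? C) → m ≤ n
  minimal≤n {m} 1+ℓ≤n+k+1 2^ℓ≡ = +-cancelʳ-≤ k m n (begin
    m + k    ≤⟨ ^-cancelʳ-≤ 2 (s≤s (s≤s z≤n)) (≤-reflexive (trans (^-distribˡ-+-* 2 m k) (trans (cong (2 ^ m *_) (sym count-C)) (sym 2^ℓ≡)))) ⟩
    ℓ        ≤⟨ ≤-pred (subst (suc ℓ ≤_) n+k+1≡1+n+k 1+ℓ≤n+k+1) ⟩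
    n + k    ∎)

  sufficient : suc ℓ ≤ n + k + 1 → Realizable n C
  sufficient 1+ℓ≤n+k+1 with m , a , R , 2^ℓ≡ ← QuadCode⇒Realizes qc
    with a′ , R′ ← Realizes-raise (minimal≤n 1+ℓ≤n+k+1 2^ℓ≡) R = a′ , Realizes⇒PairwiseDistinct qc R′ , R′
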